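{- Let $\omega$ be an indecomposable permutation, and let $\alpha$ be an interval of $\omega$ of maximum size among all intervals of $\omega$, with $|\alpha| = \ell > 1$. Let $\omega^+$ be a permutation of length $|\omega|+1$ with a distinguished entry $x$ such that deleting $x$ from $\omega^+$ leaves (a copy of) $\omega$, such that $x$ cuts $\alpha$, and such that $\alpha \cup \{x\}$ is not an interval of $\omega^+$. Then $\omega^+$ is indecomposable and $\operatorname{SD}(\omega^+) < \operatorname{SD}(\omega)$.
   Context: Permutations are written in one-line notation and identified with their sets of entries (points $(i,\omega(i))$). An interval of a permutation is a set of entries whose positions form a set of consecutive integers and whose values form a set of consecutive integers; by convention the set of all entries of the permutation is not an interval. An entry $x$ outside a set $\alpha$ of entries cuts $\alpha$ if the position of $x$ lies strictly between the leftmost and rightmost positions of entries of $\alpha$, or the value of $x$ lies strictly between the minimum and maximum values of entries of $\alpha$. With $\alpha\oplus\beta=12[\alpha,\beta]$ and $\alpha\ominus\beta=21[\alpha,\beta]$ (inflations), a permutation is indecomposable if it cannot be written as $\alpha\oplus\beta$ or $\alpha\ominus\beta$ with $\alpha,\beta$ nonempty; in an indecomposable permutation the maximal intervals (intervals not contained in a larger interval) are pairwise disjoint. For such a permutation $\omega$, $\operatorname{SD}(\omega)=\sum_{\gamma}(|\gamma|-1)$, the sum over all maximal intervals $\gamma$ of $\omega$, where $|\gamma|$ is the number of entries of $\gamma$. -}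

module Defs where

open import Data.Nat using (ℕ; zero; suc; _∸_) renaming (_<_ to _<ℕ_; _≤_ to _≤ℕ_)
open import Data.Sum using (_⊎_)
open import Data.Fin using (Fin; _≤_; _<_; toℕ)
open import Data.Fin.Properties using (_≤?_; _<?_; any?; all?)
open import Data.Fin.Subset using (Subset; _∈_; _∉_; _⊂_; _⊆_; ∣_∣; inside; outside; Nonempty)
open import Data.Fin.Subset.Properties using (_∈?_; _⊆?_)
open import Data.Fin.Permutation using (Permutation′; _⟨$⟩ʳ_)
open import Data.Vec using ([]; _∷_)
open import Data.List using (List; []; _∷_; _++_; map; filter)
open import Data.Nat.ListAction using (sum)
open import Data.Product using (_×_; _,_; ∃; ∃-syntax)
open import Relation.Nullary using (Dec; yes; no; ¬_; map′)
open import Relation.Nullary.Decidable using (_×-dec_; _→-dec_; ¬?)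

-- A permutation of length n: a bijection on positions Fin n (0-based),
-- entry at position i is the point (i , ω ⟨$⟩ʳ i).
-- A set of entries is identified with its set of positions (Subset n).

Interval : ∀ {n} → Permutation′ n → Subset n → Set
Interval {n} ω S =
  Nonempty S
  × (∀ (a b c : Fin n) → a ∈ S → b ∈ S → a ≤ c → c ≤ b → c ∈ S)
  × (∀ (a b c : Fin n) → a ∈ S → b ∈ S →
       (ω ⟨$⟩ʳ a) ≤ (ω ⟨$⟩ʳ c) → (ω ⟨$⟩ʳ c) ≤ (ω ⟨$⟩ʳ b) → c ∈ S)
  × ¬ (∀ (i : Fin n) → i ∈ S)

-- ω = α ⊕ β with |α| = k, 0 < k < n : the first k positions carry the k smallest values.
SumDecomposable : ∀ {n} → Permutation′ n → Set
SumDecomposable {n} ω =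
  ∃[ k ] (0 <ℕ k × k <ℕ n × (∀ (i : Fin n) → toℕ i <ℕ k → toℕ (ω ⟨$⟩ʳ i) <ℕ k))

-- ω = α ⊖ β with |α| = k, 0 < k < n : the first k positions carry the k largest values.
SkewDecomposable : ∀ {n} → Permutation′ n → Set
SkewDecomposable {n} ω =
  ∃[ k ] (0 <ℕ k × k <ℕ n × (∀ (i : Fin n) → toℕ i <ℕ k → n ∸ k ≤ℕ toℕ (ω ⟨$⟩ʳ i)))

Indecomposable : ∀ {n} → Permutation′ n → Set
Indecomposable ω = ¬ SumDecomposable ω × ¬ SkewDecomposable ω

MaximalInterval : ∀ {n} → Permutation′ n → Subset n → Set
MaximalInterval ω γ = Interval ω γ × ¬ (∃[ β ] (Interval ω β × γ ⊂ β))

Cuts : ∀ {n} → Permutation′ n → Fin n → Subset n → Set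
Cuts {n} ω x S =
  x ∉ S
  × ((∃[ a ] ∃[ b ] (a ∈ S × b ∈ S × a < x × x < b))
     ⊎
     (∃[ a ] ∃[ b ] (a ∈ S × b ∈ S × (ω ⟨$⟩ʳ a) < (ω ⟨$⟩ʳ x) × (ω ⟨$⟩ʳ x) < (ω ⟨$⟩ʳ b))))

anySubset? : ∀ {n} {P : Subset n → Set} → (∀ s → Dec (P s)) → Dec (∃ P)
anySubset? {zero} P? = map′ (λ p → [] , p) (λ { ([] , p) → p }) (P? [])
anySubset? {suc n} {P} P? with anySubset? (λ s → P? (outside ∷ s)) | anySubset? (λ s → P? (inside ∷ s))
... | yes (s , p) | _ = yes (outside ∷ s , p)
... | no _ | yes (s , p) = yes (inside ∷ s , p)
... | no a | no b = no λ { (outside ∷ s , p) → a (s , p) ; (inside ∷ s , p) → b (s , p) }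

_⊂?_ : ∀ {n} (p q : Subset n) → Dec (p ⊂ q)
p ⊂? q = (p ⊆? q) ×-dec any? (λ x → (x ∈? q) ×-dec ¬? (x ∈? p))

interval? : ∀ {n} (ω : Permutation′ n) (S : Subset n) → Dec (Interval ω S)
interval? ω S =
  any? (λ i → i ∈? S)
  ×-dec all? (λ a → all? (λ b → all? (λ c →
          (a ∈? S) →-dec (b ∈? S) →-dec (a ≤? c) →-dec (c ≤? b) →-dec (c ∈? S))))
  ×-dec all? (λ a → all? (λ b → all? (λ c →
          (a ∈? S) →-dec (b ∈? S) →-dec ((ω ⟨$⟩ʳ a) ≤? (ω ⟨$⟩ʳ c))
          →-dec ((ω ⟨$⟩ʳ c) ≤? (ω ⟨$⟩ʳ b)) →-dec (c ∈? S))))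
  ×-dec ¬? (all? (λ i → i ∈? S))

maximalInterval? : ∀ {n} (ω : Permutation′ n) (γ : Subset n) → Dec (MaximalInterval ω γ)
maximalInterval? ω γ = interval? ω γ ×-dec ¬? (anySubset? (λ β → interval? ω β ×-dec (γ ⊂? β)))

allSubsets : ∀ n → List (Subset n)
allSubsets zero = [] ∷ []
allSubsets (suc n) = map (outside ∷_) (allSubsets n) ++ map (inside ∷_) (allSubsets n)

SD : ∀ {n} → Permutation′ n → ℕ
SD {n} ω = sum (map (λ γ → ∣ γ ∣ ∸ 1) (filter (maximalInterval? ω) (allSubsets n)))

-- Deleting the entry at position x of ω⁺ leaves (the standardization) ω.
-- (Data.Fin.Permutation.remove performs exactly this deletion.)
DeletesTo : ∀ {n} → Permutation′ (suc n) → Fin (suc n) → Permutation′ n → Set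
DeletesTo {n} ω⁺ x ω = ∀ (i : Fin n) → remove x ω⁺ ⟨$⟩ʳ i ≡ ω ⟨$⟩ʳ i
  where open import Data.Fin.Permutation using (remove)
        open import Relation.Binary.PropositionalEquality using (_≡_)

-- The copy in ω⁺ of a set S of entries of ω (x the deleted position):
-- position i of ω corresponds to position punchIn x i of ω⁺.
copy : ∀ {n} → Subset n → Fin (suc n) → Subset (suc n)
copy S x = insertAt S x outside
  where open import Data.Vec using (insertAt)

copy∪ : ∀ {n} → Subset n → Fin (suc n) → Subset (suc n)
copy∪ S x = insertAt S x inside
  where open import Data.Vec using (insertAt)

module Submission where

-- Inserting x at a non-corner point (x cuts α) cannot create a sum or skew-sum decomposition,
-- since deleting a non-corner entry from one leaves one.  For SD, recall that the maximal
-- intervals of an indecomposable permutation of length N partition its entries, so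
-- SD = N − #(maximal intervals).  An interval of ω⁺ through x and another entry meets the copy
-- of α (x cuts α) and restricts to an interval of ω, which by maximality and disjointness lies
-- in α; then α ∪ {x} would be an interval.  So x is alone in its maximal interval, every other
-- maximal interval of ω⁺ lies over exactly one maximal interval of ω, and α lies under at least
-- two of them, since one containing all of α would contain x.  Hence ω⁺ has at least two more
-- maximal intervals but only one more entry than ω.

open import Defs
open import Data.Empty using (⊥; ⊥-elim)
import Data.Fin.Base as Fin
open import Data.Fin.Base using (Fin; toℕ; punchIn; punchOut; opposite; inject; inject≤; fromℕ; fromℕ<)
  renaming (_≤_ to _≤ᶠ_; _<_ to _<ᶠ_)
import Data.Fin.Properties as Finₚ
open import Data.Fin.Permutation
  using (Permutation′; _⟨$⟩ʳ_; _⟨$⟩ˡ_; inverseʳ; punchIn-permute; reverse; flip; _∘ₚ_)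
open import Data.Fin.Subset using (Subset; _∈_; _∉_; inside; outside; _⊆_; Nonempty; ∣_∣; ⁅_⁆; _∪_; ⋃; ⊤)
import Data.Fin.Subset.Properties as Subsetₚ
open import Data.List.Base using (List; []; _∷_; _++_; map; filter; length)
import Data.List.Properties as Listₚ
open import Data.List.Membership.Propositional using () renaming (_∈_ to _∈ₗ_)
import Data.List.Membership.Propositional.Properties as Listₚ∈
open import Data.List.Relation.Unary.All as All using (All; []; _∷_)
import Data.List.Relation.Unary.All.Properties as Allₚ
open import Data.List.Relation.Unary.AllPairs using (AllPairs; []; _∷_)
open import Data.List.Relation.Unary.Any using (here; there)
open import Data.List.Relation.Unary.Unique.Propositional using (Unique)
import Data.List.Relation.Unary.Unique.Propositional.Properties as Uniqueₚ
open import Data.Nat.Base using (ℕ; zero; suc; _+_; _∸_; _≤_; _<_; z≤n; s≤s; s≤s⁻¹)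
open import Data.Nat.ListAction using (sum)
import Data.Nat.Properties as ℕₚ
open import Data.Product using (_×_; _,_; proj₁; proj₂; ∃-syntax)
open import Data.Sum as Sum using (_⊎_; inj₁; inj₂; [_,_]; [_,_]′)
open import Data.Vec.Base as Vec using ([]; _∷_; insertAt; removeAt; lookup)
open import Data.Vec.Properties
  using (insertAt-punchIn; insertAt-lookup; removeAt-punchOut; []=⇒lookup; lookup⇒[]=; ∷-injectiveʳ)
open import Function using (id; _∘_; _$_)
open import Function.Bundles using (Injection)
open import Function.Properties.Inverse using (↔⇒↣)
open import Relation.Binary.Definitions using (tri<; tri≈; tri>)
open import Relation.Binary.PropositionalEquality
  using (_≡_; _≢_; refl; sym; trans; cong; cong₂; subst; subst₂; module ≡-Reasoning)
open import Relation.Nullary using (¬_; yes; no)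
open import Relation.Nullary.Decidable using (_×-dec_; ¬?)
open import Relation.Unary using (Decidable)

private variable
  n N : ℕ

data PunchInView (x : Fin (suc n)) : Fin (suc n) → Set where
  at      : PunchInView x x
  punched : ∀ i → PunchInView x (punchIn x i)

punchInView : (x j : Fin (suc n)) → PunchInView x j
punchInView x j with x Finₚ.≟ j
... | yes refl = at
... | no x≢j   = subst (PunchInView x) (Finₚ.punchIn-punchOut x≢j) (punched (punchOut x≢j))

insertAt-∈⁺ : ∀ (S : Subset n) x b {i} → i ∈ S → punchIn x i ∈ insertAt S x b
insertAt-∈⁺ S x b {i} i∈S = lookup⇒[]= _ _ (trans (insertAt-punchIn S x b i) ([]=⇒lookup i∈S))

insertAt-∈⁻ : ∀ (S : Subset n) x b {i} → punchIn x i ∈ insertAt S x b → i ∈ S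
insertAt-∈⁻ S x b {i} i∈ = lookup⇒[]= i S (trans (sym (insertAt-punchIn S x b i)) ([]=⇒lookup i∈))

x∉copy : ∀ (S : Subset n) x → x ∉ copy S x
x∉copy S x x∈ with trans (sym (insertAt-lookup S x outside)) ([]=⇒lookup x∈)
... | ()

x∈copy∪ : ∀ (S : Subset n) x → x ∈ copy∪ S x
x∈copy∪ S x = lookup⇒[]= x _ (insertAt-lookup S x inside)

copy-∈⁻ : ∀ (S : Subset n) x {a} → a ∈ copy S x → ∃[ i ] (i ∈ S × punchIn x i ≡ a)
copy-∈⁻ S x {a} a∈ with punchInView x a
... | at        = ⊥-elim (x∉copy S x a∈)
... | punched i = i , insertAt-∈⁻ S x outside a∈ , refl

lookup-removeAt-punchIn : ∀ (Γ : Subset (suc n)) x i → lookup (removeAt Γ x) i ≡ lookup Γ (punchIn x i)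
lookup-removeAt-punchIn Γ x i =
  trans (cong (lookup (removeAt Γ x)) (sym (Finₚ.punchOut-punchIn x)))
        (removeAt-punchOut Γ (Finₚ.punchInᵢ≢i x i ∘ sym))

removeAt-∈⁺ : ∀ (Γ : Subset (suc n)) x {i} → punchIn x i ∈ Γ → i ∈ removeAt Γ x
removeAt-∈⁺ Γ x {i} i∈ = lookup⇒[]= i _ (trans (lookup-removeAt-punchIn Γ x i) ([]=⇒lookup i∈))

removeAt-∈⁻ : ∀ (Γ : Subset (suc n)) x {i} → i ∈ removeAt Γ x → punchIn x i ∈ Γ
removeAt-∈⁻ Γ x {i} i∈ = lookup⇒[]= _ Γ (trans (sym (lookup-removeAt-punchIn Γ x i)) ([]=⇒lookup i∈))

-- Convexity along a coordinate

Convex : (Fin N → Fin N) → Subset N → Set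
Convex {N} f S = ∀ (a b c : Fin N) → a ∈ S → b ∈ S → f a ≤ᶠ f c → f c ≤ᶠ f b → c ∈ S

record Coordinate (x : Fin (suc n)) : Set where
  field
    coord⁺        : Fin (suc n) → Fin (suc n)
    coord         : Fin n → Fin n
    coord-punchIn : ∀ i → coord⁺ (punchIn x i) ≡ punchIn (coord⁺ x) (coord i)

module _ {x : Fin (suc n)} (C : Coordinate x) where
  open Coordinate C

  private
    _⁺ : Fin n → Fin (suc n)
    i ⁺ = coord⁺ (punchIn x i)

  coord-mono : ∀ {i j} → coord i ≤ᶠ coord j → i ⁺ ≤ᶠ j ⁺
  coord-mono {i} {j} le rewrite coord-punchIn i | coord-punchIn j = Finₚ.punchIn-mono-≤ _ _ _ le

  coord-cancel : ∀ {i j} → i ⁺ ≤ᶠ j ⁺ → coord i ≤ᶠ coord j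
  coord-cancel {i} {j} le rewrite coord-punchIn i | coord-punchIn j = Finₚ.punchIn-cancel-≤ _ _ _ le

  coord⁺-punchIn≢ : ∀ i → i ⁺ ≢ coord⁺ x
  coord⁺-punchIn≢ i eq = Finₚ.punchInᵢ≢i _ _ (trans (sym (coord-punchIn i)) eq)

  convex-punchIn : ∀ {S} → Convex coord S → ∀ {a b} c → a ∈ S → b ∈ S → a ⁺ ≤ᶠ c ⁺ → c ⁺ ≤ᶠ b ⁺ → c ∈ S
  convex-punchIn conv c a∈ b∈ a≤c c≤b = conv _ _ c a∈ b∈ (coord-cancel a≤c) (coord-cancel c≤b)

  removeAt-convex : ∀ {Γ} → Convex coord⁺ Γ → Convex coord (removeAt Γ x)
  removeAt-convex {Γ} conv a b c a∈ b∈ a≤c c≤b =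
    removeAt-∈⁺ Γ x (conv _ _ _ (removeAt-∈⁻ Γ x a∈) (removeAt-∈⁻ Γ x b∈) (coord-mono a≤c) (coord-mono c≤b))

  -- The cut of Cuts along one coordinate, with the cutting entries named by their positions in ω.
  CutsCopy : Subset n → Set
  CutsCopy S = ∃[ a ] ∃[ b ] (a ∈ S × b ∈ S × a ⁺ <ᶠ coord⁺ x × coord⁺ x <ᶠ b ⁺)

  cutsCopy : ∀ {S} →
             (∃[ a ] ∃[ b ] (a ∈ copy S x × b ∈ copy S x × coord⁺ a <ᶠ coord⁺ x × coord⁺ x <ᶠ coord⁺ b)) →
             CutsCopy S
  cutsCopy {S} (a , b , a∈ , b∈ , a<x , x<b) with copy-∈⁻ S x a∈ | copy-∈⁻ S x b∈
  ... | a′ , a′∈ , refl | b′ , b′∈ , refl = a′ , b′ , a′∈ , b′∈ , a<x , x<b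

  cut-meets : ∀ {S Γ} → Convex coord S → CutsCopy S → Convex coord⁺ Γ → x ∈ Γ → ∀ {y} → punchIn x y ∈ Γ →
              ∃[ z ] (z ∈ S × punchIn x z ∈ Γ)
  cut-meets {S} convS (a , b , a∈ , b∈ , a<x , x<b) convΓ x∈ {y} y∈ with ℕₚ.<-cmp (toℕ (y ⁺)) (toℕ (coord⁺ x))
  ... | tri≈ _ eq _ = ⊥-elim (coord⁺-punchIn≢ y (Finₚ.toℕ-injective eq))
  ... | tri< y<x _ _ with ℕₚ.≤-<-connex (toℕ (a ⁺)) (toℕ (y ⁺))
  ...   | inj₁ a≤y = y , convex-punchIn convS y a∈ b∈ a≤y (ℕₚ.<⇒≤ (ℕₚ.<-trans y<x x<b)) , y∈
  ...   | inj₂ y<a = a , a∈ , convΓ _ _ _ y∈ x∈ (ℕₚ.<⇒≤ y<a) (ℕₚ.<⇒≤ a<x)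
  cut-meets {S} convS (a , b , a∈ , b∈ , a<x , x<b) convΓ x∈ {y} y∈ | tri> _ _ x<y
    with ℕₚ.≤-<-connex (toℕ (y ⁺)) (toℕ (b ⁺))
  ... | inj₁ y≤b = y , convex-punchIn convS y a∈ b∈ (ℕₚ.<⇒≤ (ℕₚ.<-trans a<x x<y)) y≤b , y∈
  ... | inj₂ b<y = b , b∈ , convΓ _ _ _ x∈ y∈ (ℕₚ.<⇒≤ x<b) (ℕₚ.<⇒≤ b<y)

  copy∪-convex : ∀ {S} → Convex coord S →
                 (∀ {a} c → a ∈ S → a ⁺ ≤ᶠ c ⁺ → c ⁺ ≤ᶠ coord⁺ x → c ∈ S) →
                 (∀ {b} c → b ∈ S → coord⁺ x ≤ᶠ c ⁺ → c ⁺ ≤ᶠ b ⁺ → c ∈ S) →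
                 Convex coord⁺ (copy∪ S x)
  copy∪-convex {S} convS below above a b c a∈ b∈ a≤c c≤b with punchInView x c
  ... | at = x∈copy∪ S x
  ... | punched c′ with punchInView x a | punchInView x b
  ...   | at | at = ⊥-elim (coord⁺-punchIn≢ c′ (Finₚ.≤-antisym c≤b a≤c))
  ...   | at | punched b′ = insertAt-∈⁺ S x inside (above c′ (insertAt-∈⁻ S x inside b∈) a≤c c≤b)
  ...   | punched a′ | at = insertAt-∈⁺ S x inside (below c′ (insertAt-∈⁻ S x inside a∈) a≤c c≤b)
  ...   | punched a′ | punched b′ =
    insertAt-∈⁺ S x inside
      (convex-punchIn convS c′ (insertAt-∈⁻ S x inside a∈) (insertAt-∈⁻ S x inside b∈) a≤c c≤b)

  copy∪-convex-of-cut : ∀ {S} → Convex coord S → CutsCopy S → Convex coord⁺ (copy∪ S x)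
  copy∪-convex-of-cut {S} convS (a₀ , b₀ , a₀∈ , b₀∈ , a₀<x , x<b₀) = copy∪-convex convS below above
    where
    below : ∀ {a} c → a ∈ S → a ⁺ ≤ᶠ c ⁺ → c ⁺ ≤ᶠ coord⁺ x → c ∈ S
    below c a∈ a≤c c≤x = convex-punchIn convS c a∈ b₀∈ a≤c (ℕₚ.≤-trans c≤x (ℕₚ.<⇒≤ x<b₀))
    above : ∀ {b} c → b ∈ S → coord⁺ x ≤ᶠ c ⁺ → c ⁺ ≤ᶠ b ⁺ → c ∈ S
    above c b∈ x≤c c≤b = convex-punchIn convS c a₀∈ b∈ (ℕₚ.≤-trans (ℕₚ.<⇒≤ a₀<x) x≤c) c≤b

  copy∪-convex-of-cover : ∀ {S Γ} → Convex coord S → Convex coord⁺ Γ → x ∈ Γ → ∀ {z} → z ∈ S → punchIn x z ∈ Γ →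
                          Γ ⊆ copy∪ S x → Convex coord⁺ (copy∪ S x)
  copy∪-convex-of-cover {S} {Γ} convS convΓ x∈Γ {z} z∈S z∈Γ Γ⊆ = copy∪-convex convS below above
    where
    below : ∀ {a} c → a ∈ S → a ⁺ ≤ᶠ c ⁺ → c ⁺ ≤ᶠ coord⁺ x → c ∈ S
    below c a∈ a≤c c≤x with ℕₚ.≤-<-connex (toℕ (z ⁺)) (toℕ (c ⁺))
    ... | inj₁ z≤c = insertAt-∈⁻ S x inside (Γ⊆ (convΓ _ _ _ z∈Γ x∈Γ z≤c c≤x))
    ... | inj₂ c<z = convex-punchIn convS c a∈ z∈S a≤c (ℕₚ.<⇒≤ c<z)
    above : ∀ {b} c → b ∈ S → coord⁺ x ≤ᶠ c ⁺ → c ⁺ ≤ᶠ b ⁺ → c ∈ S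
    above c b∈ x≤c c≤b with ℕₚ.≤-<-connex (toℕ (c ⁺)) (toℕ (z ⁺))
    ... | inj₁ c≤z = insertAt-∈⁻ S x inside (Γ⊆ (convΓ _ _ _ x∈Γ z∈Γ x≤c c≤z))
    ... | inj₂ z<c = convex-punchIn convS c z∈S b∈ (ℕₚ.<⇒≤ z<c) c≤b

∪-convex : ∀ (f : Fin N → Fin N) {A B z} → z ∈ A → z ∈ B → Convex f A → Convex f B → Convex f (A ∪ B)
∪-convex f {A} {B} {z} z∈A z∈B convA convB a b c a∈ b∈ a≤c c≤b
  with Subsetₚ.x∈p∪q⁻ A B a∈ | Subsetₚ.x∈p∪q⁻ A B b∈ | ℕₚ.≤-<-connex (toℕ (f c)) (toℕ (f z))
... | inj₁ a∈A | inj₁ b∈A | _ = Subsetₚ.x∈p∪q⁺ (inj₁ (convA a b c a∈A b∈A a≤c c≤b))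
... | inj₂ a∈B | inj₂ b∈B | _ = Subsetₚ.x∈p∪q⁺ (inj₂ (convB a b c a∈B b∈B a≤c c≤b))
... | inj₁ a∈A | inj₂ b∈B | inj₁ c≤z = Subsetₚ.x∈p∪q⁺ (inj₁ (convA a z c a∈A z∈A a≤c c≤z))
... | inj₁ a∈A | inj₂ b∈B | inj₂ z<c = Subsetₚ.x∈p∪q⁺ (inj₂ (convB z b c z∈B b∈B (ℕₚ.<⇒≤ z<c) c≤b))
... | inj₂ a∈B | inj₁ b∈A | inj₁ c≤z = Subsetₚ.x∈p∪q⁺ (inj₂ (convB a z c a∈B z∈B a≤c c≤z))
... | inj₂ a∈B | inj₁ b∈A | inj₂ z<c = Subsetₚ.x∈p∪q⁺ (inj₁ (convA z b c z∈A b∈A (ℕₚ.<⇒≤ z<c) c≤b))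

-- Down-closed sets and decompositions

DownClosed : (Fin N → Fin N) → (Fin N → Set) → Set
DownClosed f D = ∀ {p q} → f q ≤ᶠ f p → D p → D q

UpClosed : (Fin N → Fin N) → (Fin N → Set) → Set
UpClosed f D = ∀ {p q} → f p ≤ᶠ f q → D p → D q

DownClosed⇒UpClosed-∁ : ∀ {f : Fin N → Fin N} {D} → DownClosed f D → UpClosed f (¬_ ∘ D)
DownClosed⇒UpClosed-∁ down p≤q ¬Dp Dq = ¬Dp (down p≤q Dq)

UpClosed⇒DownClosed-∁ : ∀ {f : Fin N → Fin N} {D} → UpClosed f D → DownClosed f (¬_ ∘ D)
UpClosed⇒DownClosed-∁ up q≤p ¬Dp Dq = ¬Dp (up q≤p Dq)

opposite-cancel-≤ : ∀ {a b : Fin N} → opposite a ≤ᶠ opposite b → b ≤ᶠ a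
opposite-cancel-≤ {N} {a} {b} le with ℕₚ.≤-<-connex (toℕ b) (toℕ a)
... | inj₁ b≤a = b≤a
... | inj₂ a<b = ⊥-elim (ℕₚ.<⇒≱ (ℕₚ.∸-monoʳ-< (s≤s a<b) (Finₚ.toℕ<n b))
                                 (subst₂ _≤_ (Finₚ.opposite-prop a) (Finₚ.opposite-prop b) le))

UpClosed⇒DownClosed-opposite : ∀ {f : Fin N → Fin N} {D} → UpClosed f D → DownClosed (opposite ∘ f) D
UpClosed⇒DownClosed-opposite up le = up (opposite-cancel-≤ le)

module _ (σ : Permutation′ N) {D : Fin N → Set} (D? : Decidable D)
         (down-pos : DownClosed id D) (down-val : DownClosed (σ ⟨$⟩ʳ_) D) where

  -- The block is the positions below the first position k outside D.
  downClosed⇒sumDecomposable : ∀ {d e} → D d → ¬ D e → SumDecomposable σ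
  downClosed⇒sumDecomposable {d} {e} Dd ¬De = toℕ k , ℕₚ.≤-<-trans z≤n (D⇒<k Dd) , Finₚ.toℕ<n k ,
                                              λ p p<k → D⇒value<k (below-k p<k)
    where
    smallest : ∃[ k ] (¬ D k × (∀ j → D (inject j)))
    smallest = Finₚ.¬∀⟶∃¬-smallest N D D? (λ all → ¬De (all e))
    k : Fin N
    k = proj₁ smallest

    below-k : ∀ {p} → toℕ p < toℕ k → D p
    below-k p<k = subst D (Finₚ.toℕ-injective (trans (Finₚ.toℕ-inject _) (Finₚ.toℕ-fromℕ< p<k)))
                          (proj₂ (proj₂ smallest) (fromℕ< p<k))

    D⇒<k : ∀ {p} → D p → toℕ p < toℕ k
    D⇒<k {p} Dp with ℕₚ.≤-<-connex (toℕ k) (toℕ p)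
    ... | inj₁ k≤p = ⊥-elim (proj₁ (proj₂ smallest) (down-pos k≤p Dp))
    ... | inj₂ p<k = p<k

    -- σ⁻¹ maps the values 0, …, σ p injectively into D, i.e. into the positions below k.
    D⇒value<k : ∀ {p} → D p → toℕ (σ ⟨$⟩ʳ p) < toℕ k
    D⇒value<k {p} Dp = Finₚ.injective⇒≤ embed-injective
      where
      value : Fin (suc (toℕ (σ ⟨$⟩ʳ p))) → Fin N
      value u = inject≤ u (Finₚ.toℕ<n (σ ⟨$⟩ʳ p))

      value≤σp : ∀ u → σ ⟨$⟩ʳ (σ ⟨$⟩ˡ value u) ≤ᶠ σ ⟨$⟩ʳ p
      value≤σp u = subst (_≤ toℕ (σ ⟨$⟩ʳ p)) (sym (trans (cong toℕ (inverseʳ σ)) (Finₚ.toℕ-inject≤ u _)))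
                         (s≤s⁻¹ (Finₚ.toℕ<n u))

      embed : Fin (suc (toℕ (σ ⟨$⟩ʳ p))) → Fin (toℕ k)
      embed u = fromℕ< (D⇒<k (down-val (value≤σp u) Dp))

      embed-injective : ∀ {u v} → embed u ≡ embed v → u ≡ v
      embed-injective {u} {v} eq = Finₚ.toℕ-injective (begin
        toℕ u                       ≡⟨ Finₚ.toℕ-inject≤ u _ ⟨
        toℕ (value u)               ≡⟨ cong toℕ (Injection.injective (↔⇒↣ (flip σ)) (Finₚ.toℕ-injective same)) ⟩
        toℕ (value v)               ≡⟨ Finₚ.toℕ-inject≤ v _ ⟩
        toℕ v                       ∎)
        where
        open ≡-Reasoning
        same : toℕ (σ ⟨$⟩ˡ value u) ≡ toℕ (σ ⟨$⟩ˡ value v)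
        same = trans (sym (Finₚ.toℕ-fromℕ< _)) (trans (cong toℕ eq) (Finₚ.toℕ-fromℕ< _))

sumDecomposable-reverse⇒skewDecomposable : (π : Permutation′ N) →
                                           SumDecomposable (π ∘ₚ reverse) → SkewDecomposable π
sumDecomposable-reverse⇒skewDecomposable {N} π (k , 0<k , k<N , block) = k , 0<k , k<N , λ p p<k →
  ∸-suc<⇒∸≤ (Finₚ.toℕ<n (π ⟨$⟩ʳ p)) (subst (_< k) (Finₚ.opposite-prop (π ⟨$⟩ʳ p)) (block p p<k))
  where
  ∸-suc<⇒∸≤ : ∀ {t k} → t < N → N ∸ suc t < k → N ∸ k ≤ t
  ∸-suc<⇒∸≤ {t} {k} (s≤s t≤M) lt =
    subst (N ∸ k ≤_) (ℕₚ.m∸[m∸n]≡n (ℕₚ.m≤n⇒m≤1+n t≤M))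
          (ℕₚ.∸-monoʳ-≤ N (subst (_≤ k) (sym (ℕₚ.+-∸-assoc 1 t≤M)) lt))

-- Maximal intervals

other-entry : 1 < N → ∀ (i : Fin N) → ∃[ j ] i ≢ j
other-entry (s≤s (s≤s z≤n)) Fin.zero    = Fin.suc Fin.zero , λ ()
other-entry (s≤s (s≤s z≤n)) (Fin.suc i) = Fin.zero , λ ()

module _ (π : Permutation′ N) where

  singleton-interval : ∀ {p q} → p ≢ q → Interval π ⁅ p ⁆
  singleton-interval {p} {q} p≢q = (p , Subsetₚ.x∈⁅x⁆ p) , singleton-convex (λ eq → eq) ,
    singleton-convex (Injection.injective (↔⇒↣ π)) , λ all → p≢q (sym (Subsetₚ.x∈⁅y⁆⇒x≡y p (all q)))
    where
    singleton-convex : ∀ {f : Fin N → Fin N} → (∀ {a b} → f a ≡ f b → a ≡ b) → Convex f ⁅ p ⁆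
    singleton-convex f-injective a b c a∈ b∈ a≤c c≤b
      with Subsetₚ.x∈⁅y⁆⇒x≡y p a∈ | Subsetₚ.x∈⁅y⁆⇒x≡y p b∈
    ... | refl | refl = subst (_∈ ⁅ p ⁆) (f-injective (Finₚ.≤-antisym a≤c c≤b)) (Subsetₚ.x∈⁅x⁆ p)

  interval-⊆-maximal : ∀ {S} → Interval π S → ∃[ γ ] (MaximalInterval π γ × S ⊆ γ)
  interval-⊆-maximal {S} I = grow (suc N) I (ℕₚ.<-≤-trans (ℕₚ.n<1+n N) (ℕₚ.m≤n+m (suc N) ∣ S ∣))
    where
    -- the fuel k bounds the number of strict enlargements still possible
    grow : ∀ k {S} → Interval π S → N < ∣ S ∣ + k → ∃[ γ ] (MaximalInterval π γ × S ⊆ γ)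
    grow zero {S} _ N<∣S∣ =
      ⊥-elim (ℕₚ.<⇒≱ N<∣S∣ (subst (_≤ N) (sym (ℕₚ.+-identityʳ ∣ S ∣)) (Subsetₚ.∣p∣≤n S)))
    grow (suc k) {S} I N<∣S∣+k+1 with maximalInterval? π S
    ... | yes max = S , max , id
    ... | no ¬max with anySubset? (λ β → interval? π β ×-dec (S ⊂? β))
    ...   | no ¬larger = ⊥-elim (¬max (I , ¬larger))
    ...   | yes (β , Iβ , S⊂β) with grow k Iβ (ℕₚ.<-≤-trans N<∣S∣+k+1 ∣S∣+k+1≤∣β∣+k)
      where
      ∣S∣+k+1≤∣β∣+k : ∣ S ∣ + suc k ≤ ∣ β ∣ + k
      ∣S∣+k+1≤∣β∣+k = subst (_≤ ∣ β ∣ + k) (sym (ℕₚ.+-suc ∣ S ∣ k))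
                             (ℕₚ.+-monoˡ-≤ k (Subsetₚ.p⊂q⇒∣p∣<∣q∣ S⊂β))
    ...     | γ , max , β⊆γ = γ , max , β⊆γ ∘ proj₁ S⊂β

  maximal-∋ : 1 < N → ∀ i → ∃[ γ ] (MaximalInterval π γ × i ∈ γ)
  maximal-∋ 1<N i with interval-⊆-maximal (singleton-interval (proj₂ (other-entry 1<N i)))
  ... | γ , max , ⁅i⁆⊆γ = γ , max , ⁅i⁆⊆γ (Subsetₚ.x∈⁅x⁆ i)

  maximal-⊆-interval : ∀ {γ β} → MaximalInterval π γ → Interval π β → γ ⊆ β → β ⊆ γ
  maximal-⊆-interval {γ} {β} (_ , ¬larger) Iβ γ⊆β {i} i∈β with i Subsetₚ.∈? γ
  ... | yes i∈γ = i∈γ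
  ... | no i∉γ = ⊥-elim (¬larger (β , Iβ , γ⊆β , i , i∈β , i∉γ))

∪-full⇒∃∖ : ∀ (A B : Subset N) → ¬ (∀ i → i ∈ B) → (∀ i → i ∈ A ∪ B) → ∃[ i ] (i ∈ A × i ∉ B)
∪-full⇒∃∖ {N} A B ¬full full with Finₚ.¬∀⟶∃¬ N (_∈ B) (Subsetₚ._∈? B) ¬full
... | i , i∉B with Subsetₚ.x∈p∪q⁻ A B (full i)
...   | inj₁ i∈A = i , i∈A , i∉B
...   | inj₂ i∈B = ⊥-elim (i∉B i∈B)

convex-cover-closed : ∀ (f : Fin N → Fin N) {I J} → Convex f I → Convex f J → (∀ p → p ∈ I ∪ J) →
                      ∀ {e} → e ∈ J → e ∉ I → UpClosed f (_∈ J) ⊎ DownClosed f (_∈ J)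
convex-cover-closed {N} f {I} {J} convI convJ cover {e} e∈J e∉I
  with Finₚ.any? (λ p → ¬? (p Subsetₚ.∈? J) ×-dec (f e Finₚ.≤? f p))
... | no ¬above = inj₁ up
  where
  up : UpClosed f (_∈ J)
  up {p} {q} p≤q p∈J with q Subsetₚ.∈? J
  ... | yes q∈J = q∈J
  ... | no q∉J = convJ p e q p∈J e∈J p≤q (ℕₚ.<⇒≤ (ℕₚ.≰⇒> (λ e≤q → ¬above (q , q∉J , e≤q))))
... | yes (r , r∉J , e≤r) = inj₂ down
  where
  in-I : ∀ {p} → p ∉ J → p ∈ I
  in-I {p} p∉J = [ id , (λ p∈J → ⊥-elim (p∉J p∈J)) ] (Subsetₚ.x∈p∪q⁻ I J (cover p))
  down : DownClosed f (_∈ J)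
  down {p} {q} q≤p p∈J with q Subsetₚ.∈? J
  ... | yes q∈J = q∈J
  ... | no q∉J with ℕₚ.≤-<-connex (toℕ (f q)) (toℕ (f e))
  ...   | inj₁ q≤e = ⊥-elim (e∉I (convI q r e (in-I q∉J) (in-I r∉J) q≤e e≤r))
  ...   | inj₂ e<q = convJ e p q e∈J p∈J (ℕₚ.<⇒≤ e<q) q≤p

module _ (π : Permutation′ N) (ind : Indecomposable π) where

  indecomposable⇒no-block : ∀ {D} → Decidable D → ∀ {d e} → D d → ¬ D e → DownClosed id D →
                            DownClosed (π ⟨$⟩ʳ_) D ⊎ UpClosed (π ⟨$⟩ʳ_) D → ⊥
  indecomposable⇒no-block D? Dd ¬De down (inj₁ down-val) =
    proj₁ ind (downClosed⇒sumDecomposable π D? down down-val Dd ¬De)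
  indecomposable⇒no-block D? Dd ¬De down (inj₂ up-val) =
    proj₂ ind (sumDecomposable-reverse⇒skewDecomposable π
      (downClosed⇒sumDecomposable (π ∘ₚ reverse) D? down
        (UpClosed⇒DownClosed-opposite {f = π ⟨$⟩ʳ_} up-val) Dd ¬De))

  maximal-overlap⇒≡ : ∀ {γ₁ γ₂ z} → MaximalInterval π γ₁ → MaximalInterval π γ₂ → z ∈ γ₁ → z ∈ γ₂ → γ₁ ≡ γ₂
  maximal-overlap⇒≡ {γ₁} {γ₂} {z}
    max₁@((_ , pos₁ , val₁ , ¬full₁) , _) max₂@((_ , pos₂ , val₂ , ¬full₂) , _) z∈₁ z∈₂
    with Finₚ.all? (Subsetₚ._∈? (γ₁ ∪ γ₂))
  ... | no ¬full = Subsetₚ.⊆-antisym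
    (maximal-⊆-interval π max₂ union (Subsetₚ.q⊆p∪q γ₁ γ₂) ∘ Subsetₚ.p⊆p∪q γ₂)
    (maximal-⊆-interval π max₁ union (Subsetₚ.p⊆p∪q γ₂) ∘ Subsetₚ.q⊆p∪q γ₁ γ₂)
    where
    union : Interval π (γ₁ ∪ γ₂)
    union = (z , Subsetₚ.x∈p∪q⁺ (inj₁ z∈₁)) , ∪-convex id z∈₁ z∈₂ pos₁ pos₂ ,
            ∪-convex (π ⟨$⟩ʳ_) z∈₁ z∈₂ val₁ val₂ , ¬full
  ... | yes full with ∪-full⇒∃∖ γ₁ γ₂ ¬full₂ full
                    | ∪-full⇒∃∖ γ₂ γ₁ ¬full₁ (λ i → subst (i ∈_) (Subsetₚ.∪-comm γ₁ γ₂) (full i))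
  ...   | d , _ , d∉₂ | e , e∈₂ , e∉₁
    with convex-cover-closed id pos₁ pos₂ full e∈₂ e∉₁ | convex-cover-closed (π ⟨$⟩ʳ_) val₁ val₂ full e∈₂ e∉₁
  ... | inj₂ down | val = ⊥-elim $ indecomposable⇒no-block (Subsetₚ._∈? γ₂) e∈₂ d∉₂ down (Sum.swap val)
  ... | inj₁ up   | val = ⊥-elim $ indecomposable⇒no-block (λ i → ¬? (i Subsetₚ.∈? γ₂)) d∉₂ (λ ¬e∈ → ¬e∈ e∈₂)
                            (UpClosed⇒DownClosed-∁ {f = id} up)
                            (Sum.map (UpClosed⇒DownClosed-∁ {f = π ⟨$⟩ʳ_})
                                     (DownClosed⇒UpClosed-∁ {f = π ⟨$⟩ʳ_}) val)

-- Deleting an entry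

toℕ-punchIn-< : ∀ (x : Fin (suc n)) i → toℕ i < toℕ x → toℕ (punchIn x i) ≡ toℕ i
toℕ-punchIn-< Fin.zero    i            ()
toℕ-punchIn-< (Fin.suc x) Fin.zero     _         = refl
toℕ-punchIn-< (Fin.suc x) (Fin.suc i)  (s≤s i<x) = cong suc (toℕ-punchIn-< x i i<x)

toℕ-punchIn-≥ : ∀ (x : Fin (suc n)) i → toℕ x ≤ toℕ i → toℕ (punchIn x i) ≡ suc (toℕ i)
toℕ-punchIn-≥ Fin.zero    i            _         = refl
toℕ-punchIn-≥ (Fin.suc x) Fin.zero     ()
toℕ-punchIn-≥ (Fin.suc x) (Fin.suc i)  (s≤s x≤i) = cong suc (toℕ-punchIn-≥ x i x≤i)

toℕ-punchIn-≤-suc : ∀ (x : Fin (suc n)) i → toℕ (punchIn x i) ≤ suc (toℕ i)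
toℕ-punchIn-≤-suc x i with ℕₚ.<-≤-connex (toℕ i) (toℕ x)
... | inj₁ i<x = ℕₚ.≤-trans (ℕₚ.≤-reflexive (toℕ-punchIn-< x i i<x)) (ℕₚ.n≤1+n _)
... | inj₂ x≤i = ℕₚ.≤-reflexive (toℕ-punchIn-≥ x i x≤i)

toℕ≤toℕ-punchIn : ∀ (x : Fin (suc n)) i → toℕ i ≤ toℕ (punchIn x i)
toℕ≤toℕ-punchIn x i with ℕₚ.<-≤-connex (toℕ i) (toℕ x)
... | inj₁ i<x = ℕₚ.≤-reflexive (sym (toℕ-punchIn-< x i i<x))
... | inj₂ x≤i = ℕₚ.≤-trans (ℕₚ.n≤1+n _) (ℕₚ.≤-reflexive (sym (toℕ-punchIn-≥ x i x≤i)))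

punchIn-≤⇒< : ∀ {m} (x : Fin (suc n)) i → toℕ x ≤ m → toℕ (punchIn x i) ≤ m → toℕ i < m
punchIn-≤⇒< x i x≤m le with ℕₚ.<-≤-connex (toℕ i) (toℕ x)
... | inj₁ i<x = ℕₚ.<-≤-trans i<x x≤m
... | inj₂ x≤i = subst (_≤ _) (toℕ-punchIn-≥ x i x≤i) le

punchIn-≥⇒≥ : ∀ {m} (x : Fin (suc n)) i → m ≤ toℕ x → m ≤ toℕ (punchIn x i) → m ≤ toℕ i
punchIn-≥⇒≥ x i m≤x le with ℕₚ.<-≤-connex (toℕ i) (toℕ x)
... | inj₁ i<x = subst (_ ≤_) (toℕ-punchIn-< x i i<x) le
... | inj₂ x≤i = ℕₚ.≤-trans m≤x x≤i

Corner : ℕ → ℕ → ℕ → Set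
Corner n P Q = (P ≡ 0 ⊎ P ≡ n) × (Q ≡ 0 ⊎ Q ≡ n)

module _ {ω : Permutation′ n} {ω⁺ x} (del : DeletesTo ω⁺ x ω) where

  value-punchIn : ∀ i → ω⁺ ⟨$⟩ʳ punchIn x i ≡ punchIn (ω⁺ ⟨$⟩ʳ x) (ω ⟨$⟩ʳ i)
  value-punchIn i = trans (punchIn-permute ω⁺ x i) (cong (punchIn _) (del i))

  private
    full-block : ∀ {k} → k < suc n → ¬ k < n → k ≡ n
    full-block k<1+n k≮n = ℕₚ.≤-antisym (s≤s⁻¹ k<1+n) (ℕₚ.≮⇒≥ k≮n)

    last-position : n ≤ toℕ x → toℕ x ≡ n
    last-position = ℕₚ.≤-antisym (s≤s⁻¹ (Finₚ.toℕ<n x))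

    value-at-last-position : toℕ x ≡ n → ∀ t → ¬ toℕ (ω⁺ ⟨$⟩ˡ t) < n → ω⁺ ⟨$⟩ʳ x ≡ t
    value-at-last-position x≡n t ¬< = trans (cong (ω⁺ ⟨$⟩ʳ_) (sym y≡x)) (inverseʳ ω⁺)
      where
      y≡x : ω⁺ ⟨$⟩ˡ t ≡ x
      y≡x = Finₚ.toℕ-injective (trans (ℕₚ.≤-antisym (s≤s⁻¹ (Finₚ.toℕ<n _)) (ℕₚ.≮⇒≥ ¬<)) (sym x≡n))

    punchIn-below : ∀ {k} i → toℕ i < k → k ≤ toℕ x → toℕ (punchIn x i) < k
    punchIn-below i i<k k≤x = subst (_< _) (sym (toℕ-punchIn-< x i (ℕₚ.<-≤-trans i<k k≤x))) i<k

  delete-sumDecomposable : SumDecomposable ω⁺ → SumDecomposable ω ⊎ Corner n (toℕ x) (toℕ (ω⁺ ⟨$⟩ʳ x))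
  delete-sumDecomposable (k , 0<k , k<1+n , block) with ℕₚ.<-≤-connex (toℕ x) k
  delete-sumDecomposable (1 , _ , _ , block) | inj₁ x<1 =
    inj₂ (inj₁ (ℕₚ.n<1⇒n≡0 x<1) , inj₁ (ℕₚ.n<1⇒n≡0 (block x x<1)))
  delete-sumDecomposable (suc (suc m) , _ , s≤s m+1<n , block) | inj₁ x<k =
    inj₁ (suc m , s≤s z≤n , m+1<n , λ i i<m+1 → punchIn-≤⇒< _ (ω ⟨$⟩ʳ i) (s≤s⁻¹ (block x x<k))
      (s≤s⁻¹ (subst (_< suc (suc m)) (cong toℕ (value-punchIn i))
        (block (punchIn x i) (ℕₚ.≤-<-trans (toℕ-punchIn-≤-suc x i) (s≤s i<m+1))))))
  delete-sumDecomposable (k , 0<k , k<1+n , block) | inj₂ k≤x with k ℕₚ.<? n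
  ... | yes k<n = inj₁ (k , 0<k , k<n , λ i i<k → ℕₚ.≤-<-trans (toℕ≤toℕ-punchIn _ (ω ⟨$⟩ʳ i))
          (subst (_< k) (cong toℕ (value-punchIn i)) (block (punchIn x i) (punchIn-below i i<k k≤x))))
  ... | no k≮n with full-block k<1+n k≮n
  ...   | refl = inj₂ (inj₂ (last-position k≤x) ,
                     inj₂ (trans (cong toℕ (value-at-last-position (last-position k≤x) (fromℕ n) ¬<n))
                                 (Finₚ.toℕ-fromℕ n)))
    where
    ¬<n : ¬ toℕ (ω⁺ ⟨$⟩ˡ fromℕ n) < n
    ¬<n y<n = ℕₚ.<-irrefl (Finₚ.toℕ-fromℕ n) (subst (_< n) (cong toℕ (inverseʳ ω⁺)) (block _ y<n))

  delete-skewDecomposable : SkewDecomposable ω⁺ → SkewDecomposable ω ⊎ Corner n (toℕ x) (toℕ (ω⁺ ⟨$⟩ʳ x))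
  delete-skewDecomposable (k , 0<k , k<1+n , block) with ℕₚ.<-≤-connex (toℕ x) k
  delete-skewDecomposable (1 , _ , _ , block) | inj₁ x<1 =
    inj₂ (inj₁ (ℕₚ.n<1⇒n≡0 x<1) , inj₂ (ℕₚ.≤-antisym (s≤s⁻¹ (Finₚ.toℕ<n (ω⁺ ⟨$⟩ʳ x))) (block x x<1)))
  delete-skewDecomposable (suc (suc m) , _ , s≤s m+1<n , block) | inj₁ x<k =
    inj₁ (suc m , s≤s z≤n , m+1<n , λ i i<m+1 → punchIn-≥⇒≥ _ (ω ⟨$⟩ʳ i) (block x x<k)
      (subst (n ∸ suc m ≤_) (cong toℕ (value-punchIn i))
        (block (punchIn x i) (ℕₚ.≤-<-trans (toℕ-punchIn-≤-suc x i) (s≤s i<m+1)))))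
  delete-skewDecomposable (k , 0<k , k<1+n , block) | inj₂ k≤x with k ℕₚ.<? n
  ... | yes k<n = inj₁ (k , 0<k , k<n , λ i i<k → s≤s⁻¹ (begin
          suc (n ∸ k)                                ≡⟨ ℕₚ.+-∸-assoc 1 (ℕₚ.<⇒≤ k<n) ⟨
          suc n ∸ k                                  ≤⟨ block (punchIn x i) (punchIn-below i i<k k≤x) ⟩
          toℕ (ω⁺ ⟨$⟩ʳ punchIn x i)                   ≡⟨ cong toℕ (value-punchIn i) ⟩
          toℕ (punchIn (ω⁺ ⟨$⟩ʳ x) (ω ⟨$⟩ʳ i))       ≤⟨ toℕ-punchIn-≤-suc _ _ ⟩
          suc (toℕ (ω ⟨$⟩ʳ i))                       ∎))
    where open ℕₚ.≤-Reasoning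
  ... | no k≮n with full-block k<1+n k≮n
  ...   | refl = inj₂ (inj₂ (last-position k≤x) ,
                     inj₁ (cong toℕ (value-at-last-position (last-position k≤x) Fin.zero ¬<n)))
    where
    ¬<n : ¬ toℕ (ω⁺ ⟨$⟩ˡ Fin.zero) < n
    ¬<n y<n = ℕₚ.n≮0 (subst₂ _≤_ (ℕₚ.m+n∸n≡m 1 n) (cong toℕ (inverseʳ ω⁺)) (block _ y<n))

inside⇒¬boundary : ∀ {t} → 0 < t → t < n → ¬ (t ≡ 0 ⊎ t ≡ n)
inside⇒¬boundary 0<t t<n = [ (λ { refl → ℕₚ.<-irrefl refl 0<t }) , (λ { refl → ℕₚ.<-irrefl refl t<n }) ]

cuts⇒¬corner : ∀ {ω⁺ : Permutation′ (suc n)} {x S} → Cuts ω⁺ x S → ¬ Corner n (toℕ x) (toℕ (ω⁺ ⟨$⟩ʳ x))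
cuts⇒¬corner (_ , inj₁ (_ , b , _ , _ , a<x , x<b)) (P , _) =
  inside⇒¬boundary (ℕₚ.≤-<-trans z≤n a<x) (ℕₚ.<-≤-trans x<b (s≤s⁻¹ (Finₚ.toℕ<n b))) P
cuts⇒¬corner {ω⁺ = ω⁺} (_ , inj₂ (_ , b , _ , _ , a<x , x<b)) (_ , Q) =
  inside⇒¬boundary (ℕₚ.≤-<-trans z≤n a<x) (ℕₚ.<-≤-trans x<b (s≤s⁻¹ (Finₚ.toℕ<n (ω⁺ ⟨$⟩ʳ b)))) Q

insert-indecomposable : ∀ {ω : Permutation′ n} {ω⁺ x S} → Indecomposable ω → DeletesTo ω⁺ x ω → Cuts ω⁺ x S →
                        Indecomposable ω⁺
insert-indecomposable {ω = ω} {ω⁺} {x} (¬sum , ¬skew) del cut =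
  [ ¬sum , ¬corner ]′ ∘ delete-sumDecomposable {ω = ω} {ω⁺} {x} del ,
  [ ¬skew , ¬corner ]′ ∘ delete-skewDecomposable {ω = ω} {ω⁺} {x} del
  where
  ¬corner : ¬ Corner _ (toℕ x) (toℕ (ω⁺ ⟨$⟩ʳ x))
  ¬corner = cuts⇒¬corner {ω⁺ = ω⁺} {x} cut

-- Counting maximal intervals

Disjoint : Subset N → Subset N → Set
Disjoint p q = ∀ {i} → i ∈ p → i ∉ q

Disjoint-tail : ∀ {b c} {p q : Subset N} → Disjoint (b ∷ p) (c ∷ q) → Disjoint p q
Disjoint-tail disjoint i∈p i∈q = disjoint (Vec.there i∈p) (Vec.there i∈q)

∣∪∣-disjoint : ∀ (p q : Subset N) → Disjoint p q → ∣ p ∪ q ∣ ≡ ∣ p ∣ + ∣ q ∣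
∣∪∣-disjoint []            []            _        = refl
∣∪∣-disjoint (inside ∷ p)  (inside ∷ q)  disjoint = ⊥-elim (disjoint Vec.here Vec.here)
∣∪∣-disjoint (inside ∷ p)  (outside ∷ q) disjoint = cong suc (∣∪∣-disjoint p q (Disjoint-tail disjoint))
∣∪∣-disjoint (outside ∷ p) (inside ∷ q)  disjoint =
  trans (cong suc (∣∪∣-disjoint p q (Disjoint-tail disjoint))) (sym (ℕₚ.+-suc ∣ p ∣ ∣ q ∣))
∣∪∣-disjoint (outside ∷ p) (outside ∷ q) disjoint = ∣∪∣-disjoint p q (Disjoint-tail disjoint)

∈⋃⁺ : ∀ {L : List (Subset N)} {γ i} → γ ∈ₗ L → i ∈ γ → i ∈ ⋃ L
∈⋃⁺ (here refl) i∈γ = Subsetₚ.x∈p∪q⁺ (inj₁ i∈γ)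
∈⋃⁺ (there γ∈L) i∈γ = Subsetₚ.x∈p∪q⁺ (inj₂ (∈⋃⁺ γ∈L i∈γ))

∈⋃⁻ : ∀ (L : List (Subset N)) {i} → i ∈ ⋃ L → ∃[ γ ] (γ ∈ₗ L × i ∈ γ)
∈⋃⁻ []      i∈ = ⊥-elim (Subsetₚ.∉⊥ i∈)
∈⋃⁻ (γ ∷ L) i∈ with Subsetₚ.x∈p∪q⁻ γ (⋃ L) i∈
... | inj₁ i∈γ = γ , here refl , i∈γ
... | inj₂ i∈⋃ with ∈⋃⁻ L i∈⋃
...   | δ , δ∈L , i∈δ = δ , there δ∈L , i∈δ

∣⋃∣≡sum : ∀ (L : List (Subset N)) → AllPairs Disjoint L → ∣ ⋃ L ∣ ≡ sum (map ∣_∣ L)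
∣⋃∣≡sum {N} []      []                   = Subsetₚ.∣⊥∣≡0 N
∣⋃∣≡sum     (γ ∷ L) (γ-disjoint ∷ pairs) =
  trans (∣∪∣-disjoint γ (⋃ L) disjoint) (cong (∣ γ ∣ +_) (∣⋃∣≡sum L pairs))
  where
  disjoint : Disjoint γ (⋃ L)
  disjoint i∈γ i∈⋃ with ∈⋃⁻ L i∈⋃
  ... | δ , δ∈L , i∈δ = All.lookup γ-disjoint δ∈L i∈γ i∈δ

sum-∸1+length : ∀ (ms : List ℕ) → All (0 <_) ms → sum (map (_∸ 1) ms) + length ms ≡ sum ms
sum-∸1+length []           []      = refl
sum-∸1+length (suc m ∷ ms) (_ ∷ pos) = trans (ℕₚ.+-suc (m + _) (length ms))
  (cong suc (trans (ℕₚ.+-assoc m _ _) (cong (m +_) (sum-∸1+length ms pos))))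

Unique-⊆⇒length≤ : ∀ {A : Set} {xs ys : List A} → Unique xs → (∀ {a} → a ∈ₗ xs → a ∈ₗ ys) →
                   length xs ≤ length ys
Unique-⊆⇒length≤ {xs = []}     _ _ = z≤n
Unique-⊆⇒length≤ {xs = a ∷ xs} (a∉xs ∷ unique) xs⊆ys with Listₚ∈.∈-∃++ (xs⊆ys (here refl))
... | us , vs , refl = subst (suc (length xs) ≤_) (sym (Listₚ.length-++-sucʳ us a vs))
                             (s≤s (Unique-⊆⇒length≤ unique xs⊆us++vs))
  where
  xs⊆us++vs : ∀ {b} → b ∈ₗ xs → b ∈ₗ us ++ vs
  xs⊆us++vs b∈xs with Listₚ∈.∈-++⁻ us (xs⊆ys (there b∈xs))
  ... | inj₁ b∈us          = Listₚ∈.∈-++⁺ˡ b∈us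
  ... | inj₂ (here refl)   = ⊥-elim (All.lookup a∉xs b∈xs refl)
  ... | inj₂ (there b∈vs)  = Listₚ∈.∈-++⁺ʳ us b∈vs

Unique-map⁺ : ∀ {A B : Set} {P : A → Set} (f : A → B) → (∀ {a b} → P a → P b → f a ≡ f b → a ≡ b) →
              ∀ {xs} → All P xs → Unique xs → Unique (map f xs)
Unique-map⁺ f injective []         []             = []
Unique-map⁺ f injective (Pa ∷ Pas) (a∉as ∷ unique) =
  Allₚ.map⁺ (All.zipWith (λ (Pb , a≢b) → a≢b ∘ injective Pa Pb) (Pas , a∉as)) ∷
  Unique-map⁺ f injective Pas unique

allSubsets-complete : ∀ (S : Subset N) → S ∈ₗ allSubsets N
allSubsets-complete {zero}  []            = here refl
allSubsets-complete {suc N} (outside ∷ S) = Listₚ∈.∈-++⁺ˡ (Listₚ∈.∈-map⁺ (outside ∷_) (allSubsets-complete S))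
allSubsets-complete {suc N} (inside ∷ S)  =
  Listₚ∈.∈-++⁺ʳ (map (outside ∷_) (allSubsets N)) (Listₚ∈.∈-map⁺ (inside ∷_) (allSubsets-complete S))

allSubsets-unique : ∀ N → Unique (allSubsets N)
allSubsets-unique zero    = [] ∷ []
allSubsets-unique (suc N) =
  Uniqueₚ.++⁺ (Uniqueₚ.map⁺ ∷-injectiveʳ (allSubsets-unique N)) (Uniqueₚ.map⁺ ∷-injectiveʳ (allSubsets-unique N))
              heads-differ
  where
  heads-differ : ∀ {S} → ¬ (S ∈ₗ map (outside ∷_) (allSubsets N) × S ∈ₗ map (inside ∷_) (allSubsets N))
  heads-differ (S∈₁ , S∈₂) with Listₚ∈.∈-map⁻ (outside ∷_) S∈₁ | Listₚ∈.∈-map⁻ (inside ∷_) S∈₂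
  ... | _ , _ , refl | _ , _ , ()

module _ (π : Permutation′ N) where

  opaque
    maximalIntervals : List (Subset N)
    maximalIntervals = filter (maximalInterval? π) (allSubsets N)

    SD≡sum-maximalIntervals : SD π ≡ sum (map (λ γ → ∣ γ ∣ ∸ 1) maximalIntervals)
    SD≡sum-maximalIntervals = refl

    maximalIntervals-unique : Unique maximalIntervals
    maximalIntervals-unique = Uniqueₚ.filter⁺ (maximalInterval? π) (allSubsets-unique N)

    ∈-maximalIntervals⁺ : ∀ {γ} → MaximalInterval π γ → γ ∈ₗ maximalIntervals
    ∈-maximalIntervals⁺ {γ} max = Listₚ∈.∈-filter⁺ (maximalInterval? π) (allSubsets-complete γ) max

    ∈-maximalIntervals⁻ : ∀ {γ} → γ ∈ₗ maximalIntervals → MaximalInterval π γ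
    ∈-maximalIntervals⁻ γ∈ = proj₂ (Listₚ∈.∈-filter⁻ (maximalInterval? π) {xs = allSubsets N} γ∈)

  SD+#maximal : Indecomposable π → 1 < N → SD π + length maximalIntervals ≡ N
  SD+#maximal ind 1<N = begin
    SD π + length M
      ≡⟨ cong (_+ length M) SD≡sum-maximalIntervals ⟩
    sum (map (λ γ → ∣ γ ∣ ∸ 1) M) + length M
      ≡⟨ cong₂ _+_ (cong sum (Listₚ.map-∘ M)) (sym (Listₚ.length-map ∣_∣ M)) ⟩
    sum (map (_∸ 1) (map ∣_∣ M)) + length (map ∣_∣ M)
      ≡⟨ sum-∸1+length (map ∣_∣ M) (Allₚ.map⁺ (All.map nonempty-size M-maximal)) ⟩
    sum (map ∣_∣ M)
      ≡⟨ ∣⋃∣≡sum M (pairwise-disjoint M-maximal maximalIntervals-unique) ⟨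
    ∣ ⋃ M ∣
      ≡⟨ cong ∣_∣ (Subsetₚ.⊆-antisym (λ _ → Subsetₚ.∈⊤) covers) ⟩
    ∣ ⊤ {N} ∣
      ≡⟨ Subsetₚ.∣⊤∣≡n N ⟩
    N ∎
    where
    open ≡-Reasoning
    M : List (Subset N)
    M = maximalIntervals

    M-maximal : All (MaximalInterval π) M
    M-maximal = All.tabulate ∈-maximalIntervals⁻

    nonempty-size : ∀ {γ} → MaximalInterval π γ → 0 < ∣ γ ∣
    nonempty-size (((i , i∈γ) , _) , _) = ℕₚ.≤-<-trans z≤n (Subsetₚ.x∈p⇒∣p-x∣<∣p∣ i∈γ)

    pairwise-disjoint : ∀ {L} → All (MaximalInterval π) L → AllPairs _≢_ L → AllPairs Disjoint L
    pairwise-disjoint []             []            = []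
    pairwise-disjoint (max ∷ maxs) (γ≢s ∷ pairs) =
      All.zipWith (λ (max′ , γ≢δ) {_} → disjoint max max′ γ≢δ) (maxs , γ≢s) ∷ pairwise-disjoint maxs pairs
      where
      disjoint : ∀ {γ δ} → MaximalInterval π γ → MaximalInterval π δ → γ ≢ δ → Disjoint γ δ
      disjoint max max′ γ≢δ i∈γ i∈δ = γ≢δ (maximal-overlap⇒≡ π ind max max′ i∈γ i∈δ)

    covers : ⊤ {N} ⊆ ⋃ M
    covers {i} _ with maximal-∋ π 1<N i
    ... | γ , max , i∈γ = ∈⋃⁺ (∈-maximalIntervals⁺ max) i∈γ

-- Inserting an entry that cuts α

positions : (x : Fin (suc n)) → Coordinate x
positions x = record { coord⁺ = id ; coord = id ; coord-punchIn = λ _ → refl }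

values : ∀ {ω : Permutation′ n} {ω⁺ x} → DeletesTo ω⁺ x ω → Coordinate x
values {ω = ω} {ω⁺} {x} del = record
  { coord⁺ = ω⁺ ⟨$⟩ʳ_ ; coord = ω ⟨$⟩ʳ_ ; coord-punchIn = value-punchIn {ω = ω} {ω⁺} {x} del }

module Insertion (ω : Permutation′ n) (α : Subset n) (ω⁺ : Permutation′ (suc n)) (x : Fin (suc n))
                 (del : DeletesTo ω⁺ x ω) (α-interval : Interval ω α) (cut : Cuts ω⁺ x (copy α x)) where

  private
    α-positions : Convex id α
    α-positions = proj₁ (proj₂ α-interval)

    α-values : Convex (ω ⟨$⟩ʳ_) α
    α-values = proj₁ (proj₂ (proj₂ α-interval))

    ω-values : Coordinate x
    ω-values = values {ω = ω} {ω⁺} {x} del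

  cut-along : CutsCopy (positions x) α ⊎ CutsCopy ω-values α
  cut-along = Sum.map (cutsCopy (positions x)) (cutsCopy ω-values) (proj₂ cut)

  interval⊇copy⇒∋x : ∀ {Γ} → Interval ω⁺ Γ → copy α x ⊆ Γ → x ∈ Γ
  interval⊇copy⇒∋x (_ , pos , val , _) copy⊆Γ with proj₂ cut
  ... | inj₁ (a , b , a∈ , b∈ , a<x , x<b) = pos a b x (copy⊆Γ a∈) (copy⊆Γ b∈) (ℕₚ.<⇒≤ a<x) (ℕₚ.<⇒≤ x<b)
  ... | inj₂ (a , b , a∈ , b∈ , a<x , x<b) = val a b x (copy⊆Γ a∈) (copy⊆Γ b∈) (ℕₚ.<⇒≤ a<x) (ℕₚ.<⇒≤ x<b)

  interval-meets-α : ∀ {Γ} → Interval ω⁺ Γ → x ∈ Γ → ∀ {y} → punchIn x y ∈ Γ → ∃[ z ] (z ∈ α × punchIn x z ∈ Γ)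
  interval-meets-α (_ , pos , val , _) x∈Γ y∈Γ with cut-along
  ... | inj₁ cut-pos = cut-meets (positions x) α-positions cut-pos pos x∈Γ y∈Γ
  ... | inj₂ cut-val = cut-meets ω-values α-values cut-val val x∈Γ y∈Γ

  removeAt-interval : ∀ {Γ} → Interval ω⁺ Γ → ∀ {y} → punchIn x y ∈ Γ → Interval ω (removeAt Γ x)
  removeAt-interval {Γ} I@(_ , pos , val , ¬full) {y} y∈Γ =
    (y , removeAt-∈⁺ Γ x y∈Γ) , removeAt-convex (positions x) pos , removeAt-convex ω-values val , ¬full ∘ full
    where
    full : (∀ i → i ∈ removeAt Γ x) → ∀ j → j ∈ Γ
    full all j with punchInView x j
    ... | punched i = removeAt-∈⁻ Γ x (all i)
    ... | at        = interval⊇copy⇒∋x I copy⊆Γ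
      where
      copy⊆Γ : copy α x ⊆ Γ
      copy⊆Γ a∈ with copy-∈⁻ α x a∈
      ... | i , _ , refl = removeAt-∈⁻ Γ x (all i)

  copy∪-interval : ∀ {Γ} → Interval ω⁺ Γ → x ∈ Γ → ∀ {z} → z ∈ α → punchIn x z ∈ Γ → Γ ⊆ copy∪ α x →
                   Interval ω⁺ (copy∪ α x)
  copy∪-interval (_ , pos , val , _) x∈Γ z∈α z∈Γ Γ⊆ = (x , x∈copy∪ α x) , convex-pos , convex-val , ¬full
    where
    ¬full : ¬ (∀ j → j ∈ copy∪ α x)
    ¬full all = proj₂ (proj₂ (proj₂ α-interval)) (λ i → insertAt-∈⁻ α x inside (all (punchIn x i)))
    convex-pos : Convex id (copy∪ α x)
    convex-pos with cut-along
    ... | inj₁ cut-pos = copy∪-convex-of-cut (positions x) α-positions cut-pos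
    ... | inj₂ _       = copy∪-convex-of-cover (positions x) α-positions pos x∈Γ z∈α z∈Γ Γ⊆
    convex-val : Convex (ω⁺ ⟨$⟩ʳ_) (copy∪ α x)
    convex-val with cut-along
    ... | inj₁ _       = copy∪-convex-of-cover ω-values α-values val x∈Γ z∈α z∈Γ Γ⊆
    ... | inj₂ cut-val = copy∪-convex-of-cut ω-values α-values cut-val

  module _ (ind : Indecomposable ω) (α-maximal : MaximalInterval ω α) (¬copy∪ : ¬ Interval ω⁺ (copy∪ α x)) where

    -- A larger interval through x restricts into a maximal interval of ω meeting α, hence into α itself.
    x-isolated : ∀ {Γ} → Interval ω⁺ Γ → x ∈ Γ → ∀ {y} → punchIn x y ∉ Γ
    x-isolated {Γ} I x∈Γ y∈Γ with interval-meets-α I x∈Γ y∈Γ | interval-⊆-maximal ω (removeAt-interval I y∈Γ)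
    ... | z , z∈α , z∈Γ | δ , δ-maximal , ⊆δ
      with maximal-overlap⇒≡ ω ind δ-maximal α-maximal (⊆δ (removeAt-∈⁺ Γ x z∈Γ)) z∈α
    ... | refl = ¬copy∪ (copy∪-interval I x∈Γ z∈α z∈Γ Γ⊆copy∪)
      where
      Γ⊆copy∪ : Γ ⊆ copy∪ α x
      Γ⊆copy∪ {j} j∈Γ with punchInView x j
      ... | at        = x∈copy∪ α x
      ... | punched i = insertAt-∈⁺ α x inside (⊆δ (removeAt-∈⁺ Γ x j∈Γ))

    meets-one-maximal : ∀ {Γ γ₁ γ₂ i₁ i₂} → Interval ω⁺ Γ → MaximalInterval ω γ₁ → MaximalInterval ω γ₂ →
                        i₁ ∈ γ₁ → i₂ ∈ γ₂ → punchIn x i₁ ∈ Γ → punchIn x i₂ ∈ Γ → γ₁ ≡ γ₂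
    meets-one-maximal {Γ} I max₁ max₂ i₁∈γ₁ i₂∈γ₂ i₁∈Γ i₂∈Γ with interval-⊆-maximal ω (removeAt-interval I i₁∈Γ)
    ... | δ , δ-maximal , ⊆δ =
      trans (maximal-overlap⇒≡ ω ind max₁ δ-maximal i₁∈γ₁ (⊆δ (removeAt-∈⁺ Γ x i₁∈Γ)))
            (maximal-overlap⇒≡ ω ind δ-maximal max₂ (⊆δ (removeAt-∈⁺ Γ x i₂∈Γ)) i₂∈γ₂)

    private
      1<1+n : 1 < suc n
      1<1+n = s≤s (ℕₚ.≤-<-trans z≤n (Finₚ.toℕ<n (proj₁ (proj₁ α-interval))))

    -- Opaque, as unfolding the decision procedures behind these choices stalls type checking.
    opaque
      maximal⁺ : Fin (suc n) → Subset (suc n)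
      maximal⁺ j = proj₁ (maximal-∋ ω⁺ 1<1+n j)

      maximal⁺-maximal : ∀ j → MaximalInterval ω⁺ (maximal⁺ j)
      maximal⁺-maximal j = proj₁ (proj₂ (maximal-∋ ω⁺ 1<1+n j))

      ∈maximal⁺ : ∀ j → j ∈ maximal⁺ j
      ∈maximal⁺ j = proj₂ (proj₂ (maximal-∋ ω⁺ 1<1+n j))

    -- junk value maximal⁺ x on the empty set
    opaque
      image : Subset n → Subset (suc n)
      image γ with Subsetₚ.nonempty? γ
      ... | yes (i , _) = maximal⁺ (punchIn x i)
      ... | no _        = maximal⁺ x

      image-spec : ∀ {γ} → Nonempty γ → ∃[ i ] (i ∈ γ × image γ ≡ maximal⁺ (punchIn x i))
      image-spec {γ} ne with Subsetₚ.nonempty? γ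
      ... | yes (i , i∈γ) = i , i∈γ , refl
      ... | no empty      = ⊥-elim (empty ne)

    image-maximal : ∀ {γ} → MaximalInterval ω γ → MaximalInterval ω⁺ (image γ)
    image-maximal (((_ , ne) , _) , _) with image-spec (_ , ne)
    ... | i , _ , eq = subst (MaximalInterval ω⁺) (sym eq) (maximal⁺-maximal (punchIn x i))

    image-meets : ∀ {γ} → MaximalInterval ω γ → ∃[ i ] (i ∈ γ × punchIn x i ∈ image γ)
    image-meets (((_ , ne) , _) , _) with image-spec (_ , ne)
    ... | i , i∈γ , eq = i , i∈γ , subst (punchIn x i ∈_) (sym eq) (∈maximal⁺ (punchIn x i))

    image-injective : ∀ {γ₁ γ₂} → MaximalInterval ω γ₁ → MaximalInterval ω γ₂ → image γ₁ ≡ image γ₂ → γ₁ ≡ γ₂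
    image-injective {γ₁} max₁ max₂ eq with image-meets max₁ | image-meets max₂
    ... | i₁ , i₁∈γ₁ , i₁∈ | i₂ , i₂∈γ₂ , i₂∈ =
      meets-one-maximal (proj₁ (image-maximal max₁)) max₁ max₂ i₁∈γ₁ i₂∈γ₂ i₁∈
                        (subst (punchIn x i₂ ∈_) (sym eq) i₂∈)

    maximal⁺x≢image : ∀ {γ} → MaximalInterval ω γ → maximal⁺ x ≢ image γ
    maximal⁺x≢image max eq with image-meets max
    ... | i , _ , i∈ = x-isolated (proj₁ (maximal⁺-maximal x)) (∈maximal⁺ x)
                                  (subst (punchIn x i ∈_) (sym eq) i∈)

    -- If image α contained the whole copy of α, it would contain x as well.
    opaque
      α-split : ∃[ a ] (a ∈ α × punchIn x a ∉ image α)
      α-split with Finₚ.any? (λ a → (a Subsetₚ.∈? α) ×-dec ¬? (punchIn x a Subsetₚ.∈? image α))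
      ... | yes found = found
      ... | no ¬found with image-meets α-maximal
      ...   | i , _ , i∈ = ⊥-elim (x-isolated image-α (interval⊇copy⇒∋x image-α copy⊆) i∈)
        where
        image-α : Interval ω⁺ (image α)
        image-α = proj₁ (image-maximal α-maximal)
        copy⊆ : copy α x ⊆ image α
        copy⊆ a∈ with copy-∈⁻ α x a∈
        ... | a , a∈α , refl with punchIn x a Subsetₚ.∈? image α
        ...   | yes a∈ = a∈
        ...   | no a∉  = ⊥-elim (¬found (a , a∈α , a∉))

    private
      a⋆ : Fin n
      a⋆ = proj₁ α-split

    maximal⁺x≢maximal⁺a⋆ : maximal⁺ x ≢ maximal⁺ (punchIn x a⋆)
    maximal⁺x≢maximal⁺a⋆ eq =
      x-isolated (proj₁ (maximal⁺-maximal x)) (∈maximal⁺ x) (subst (punchIn x a⋆ ∈_) (sym eq) (∈maximal⁺ _))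

    maximal⁺a⋆≢image : ∀ {γ} → MaximalInterval ω γ → maximal⁺ (punchIn x a⋆) ≢ image γ
    maximal⁺a⋆≢image {γ} max eq with image-meets max
    ... | i , i∈γ , i∈ = proj₂ (proj₂ α-split) (subst (λ δ → punchIn x a⋆ ∈ image δ) (sym α≡γ) a⋆∈)
      where
      a⋆∈ : punchIn x a⋆ ∈ image γ
      a⋆∈ = subst (punchIn x a⋆ ∈_) eq (∈maximal⁺ _)
      α≡γ : α ≡ γ
      α≡γ = meets-one-maximal (proj₁ (image-maximal max)) α-maximal max (proj₁ (proj₂ α-split)) i∈γ a⋆∈ i∈

    more-maximal-intervals : 2 + length (maximalIntervals ω) ≤ length (maximalIntervals ω⁺)
    more-maximal-intervals = subst (_≤ length (maximalIntervals ω⁺)) (cong (2 +_) (Listₚ.length-map image M))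
                                   (Unique-⊆⇒length≤ extended-unique extended⊆)
      where
      M : List (Subset n)
      M = maximalIntervals ω

      M-maximal : All (MaximalInterval ω) M
      M-maximal = All.tabulate (∈-maximalIntervals⁻ ω)

      extended : List (Subset (suc n))
      extended = maximal⁺ x ∷ maximal⁺ (punchIn x a⋆) ∷ map image M

      extended-unique : Unique extended
      extended-unique =
        (maximal⁺x≢maximal⁺a⋆ ∷ Allₚ.map⁺ (All.map maximal⁺x≢image M-maximal)) ∷
        Allₚ.map⁺ (All.map maximal⁺a⋆≢image M-maximal) ∷
        Unique-map⁺ image image-injective M-maximal (maximalIntervals-unique ω)

      extended⊆ : ∀ {Γ} → Γ ∈ₗ extended → Γ ∈ₗ maximalIntervals ω⁺
      extended⊆ (here refl)         = ∈-maximalIntervals⁺ ω⁺ (maximal⁺-maximal x)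
      extended⊆ (there (here refl)) = ∈-maximalIntervals⁺ ω⁺ (maximal⁺-maximal _)
      extended⊆ (there (there Γ∈)) with Listₚ∈.∈-map⁻ image Γ∈
      ... | γ , γ∈M , refl = ∈-maximalIntervals⁺ ω⁺ (image-maximal (∈-maximalIntervals⁻ ω γ∈M))

smaller-remainder : ∀ {s l s′ l′ m} → s + l ≡ m → s′ + l′ ≡ suc m → 2 + l ≤ l′ → s′ < s
smaller-remainder {s} {l} {s′} {l′} {m} sum sum′ 2+l≤l′ = ℕₚ.+-cancelʳ-≤ l (suc s′) s (s≤s⁻¹ (begin
  suc (suc s′ + l)   ≡⟨ cong suc (ℕₚ.+-suc s′ l) ⟨
  suc (s′ + suc l)   ≡⟨ ℕₚ.+-suc s′ (suc l) ⟨
  s′ + (2 + l)       ≤⟨ ℕₚ.+-monoʳ-≤ s′ 2+l≤l′ ⟩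
  s′ + l′            ≡⟨ trans sum′ (cong suc (sym sum)) ⟩
  suc (s + l)        ∎))
  where open ℕₚ.≤-Reasoning

lemma2p2 : ∀ {n} (ω : Permutation′ n) (α : Subset n)
    → Indecomposable ω
    → Interval ω α
    → (∀ (β : Subset n) → Interval ω β → ∣ β ∣ ≤ ∣ α ∣)
    → 1 < ∣ α ∣
    → (ω⁺ : Permutation′ (suc n)) (x : Fin (suc n))
    → DeletesTo ω⁺ x ω
    → Cuts ω⁺ x (copy α x)
    → ¬ Interval ω⁺ (copy∪ α x)
    → Indecomposable ω⁺ × SD ω⁺ < SD ω
lemma2p2 {n} ω α ind α-interval α-largest 1<∣α∣ ω⁺ x del cut ¬copy∪ = ω⁺-indecomposable , SD-decreases
  where
  open Insertion ω α ω⁺ x del α-interval cut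

  ω⁺-indecomposable : Indecomposable ω⁺
  ω⁺-indecomposable = insert-indecomposable {ω = ω} {ω⁺} {x} ind del cut

  α-maximal : MaximalInterval ω α
  α-maximal = α-interval , λ (β , β-interval , α⊂β) →
    ℕₚ.<⇒≱ (Subsetₚ.p⊂q⇒∣p∣<∣q∣ α⊂β) (α-largest β β-interval)

  SD-decreases : SD ω⁺ < SD ω
  SD-decreases = smaller-remainder
    (SD+#maximal ω ind 1<n)
    (SD+#maximal ω⁺ ω⁺-indecomposable (ℕₚ.m<n⇒m<1+n 1<n))
    (more-maximal-intervals ind α-maximal ¬copy∪)
    where
    1<n : 1 < n
    1<n = ℕₚ.<-≤-trans 1<∣α∣ (Subsetₚ.∣p∣≤n α)
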